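{- For every integer $n\ge 3$, $M^{[2]}(1,n)=\left\lceil\frac{n}{2}\right\rceil$.
   Context: Group testing setting: a population of $n$ items contains exactly $d$ defective items, where $d$ is known in advance. A test is applied to a subset of the population and its outcome is positive if the subset contains at least one defective item and negative otherwise. Tests are performed sequentially (adaptively): the result of each test is known before the next test is chosen. An algorithm solves the $(d,n)$-problem if it always identifies the set of defective items. $M^{[k]}(d,n)$ denotes the minimum, over all such sequential algorithms in which every tested subset has size exactly $k$, of the worst-case number of tests used; if no such algorithm exists, $M^{[k]}(d,n)=\infty$. -}

module Defs where

open import Data.Nat.Base using (ℕ; zero; suc; _≡ᵇ_; _≤_)
open import Data.Bool.Base using (Bool; true; false; not)
open import Data.Fin.Subset using (Subset; _∩_; ∣_∣)
open import Data.Product.Base using (_×_; _,_; proj₁; proj₂; Σ; ∃)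
open import Relation.Binary.PropositionalEquality using (_≡_)

testOutcome : ∀ {n} → Subset n → Subset n → Bool
testOutcome T D = not (∣ T ∩ D ∣ ≡ᵇ 0)

-- A sequential (adaptive) group testing algorithm on items Fin n,
-- represented as a decision tree.
data Algorithm (n : ℕ) : Set where
  leaf : Subset n → Algorithm n
  node : (T : Subset n) → (onPositive onNegative : Algorithm n) → Algorithm n

run : ∀ {n} → Algorithm n → Subset n → Subset n × ℕ
runBranch : ∀ {n} → Bool → Algorithm n → Algorithm n → Subset n → Subset n × ℕ

run (leaf S) D = S , 0
run (node T p q) D = runBranch (testOutcome T D) p q D

runBranch true  p q D = proj₁ (run p D) , suc (proj₂ (run p D))
runBranch false p q D = proj₁ (run q D) , suc (proj₂ (run q D))

data TestsOfSize (k : ℕ) {n : ℕ} : Algorithm n → Set where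
  leaf : ∀ S → TestsOfSize k (leaf S)
  node : ∀ {T p q} → ∣ T ∣ ≡ k → TestsOfSize k p → TestsOfSize k q →
         TestsOfSize k (node T p q)

Solves : ∀ (d : ℕ) {n} → Algorithm n → Set
Solves d {n} A = ∀ (D : Subset n) → ∣ D ∣ ≡ d → proj₁ (run A D) ≡ D

WorstCaseAtMost : ∀ (d : ℕ) {n} → Algorithm n → ℕ → Set
WorstCaseAtMost d {n} A m = ∀ (D : Subset n) → ∣ D ∣ ≡ d → proj₂ (run A D) ≤ m

Admissible : (k d n : ℕ) → Algorithm n → Set
Admissible k d n A = TestsOfSize k A × Solves d A

-- M^[k](d,n) = m  (m a finite value): some admissible algorithm has
-- worst case ≤ m, and every admissible algorithm has worst case ≥ m
-- (i.e. some admissible input forces at least m tests).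
M≡ : (k d n m : ℕ) → Set
M≡ k d n m =
  (Σ (Algorithm n) λ A → Admissible k d n A × WorstCaseAtMost d A m)
  × (∀ (A : Algorithm n) → Admissible k d n A →
       Σ (Subset n) λ D → (∣ D ∣ ≡ d) × (m ≤ proj₂ (run A D)))

-- Lower bound: a test of size 2 contains at most two of the items still
-- compatible with the answers given so far, so an adversary who always answers
-- towards the larger part loses at most two of them per test, and a leaf cannot
-- serve two items; hence some single defective costs ⌈n/2⌉ tests.
-- Upper bound: test disjoint pairs {x,y} one after another and split a positive
-- pair by testing {x,z} for an item z outside it.  When only two items are left
-- they are split in the same way against an item already cleared, without
-- testing their pair.
module Submission where

open import Defs
open import Data.Nat.Base using (ℕ; zero; suc; pred; _+_; _<_; _≤_; _≡ᵇ_; z≤n; s≤s; ⌈_/2⌉)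
open import Data.Nat.Properties
  using (≤-trans; ≤-reflexive; +-comm; +-suc; +-monoˡ-≤; +-mono-≤; ⌈n/2⌉-mono; _≤?_; ≰⇒>; <⇒≱; module ≤-Reasoning)
open import Data.Bool.Base using (true; false; not)
open import Data.Bool.Properties using (¬-not)
open import Data.Fin.Base using (Fin; zero; suc)
open import Data.Fin.Subset using (Subset; _∩_; _∪_; ∁; ∣_∣; ⁅_⁆; ⊥; ⊤; _∈_; _∉_; _⊆_; Nonempty; outside; inside)
open import Data.Fin.Subset.Properties
  using (nonempty?; Empty-unique; ∣⊥∣≡0; ∣⊤∣≡n; x∈⁅x⁆; x∈⁅y⁆⇒x≡y; ∣⁅x⁆∣≡1; p⊆q⇒∣p∣≤∣q∣;
         x∈p∩q⁻; p∩q⊆p; x∈∁p⇒x∉p; ∣p∩q∣≤∣q∣; x∈p∪q⁻; x∈p∪q⁺; ∩-zeroʳ; ∪-identityˡ; ∪-identityʳ)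
open import Data.Vec.Base using ([]; _∷_; lookup)
open import Data.Vec.Properties using ([]=⇒lookup; lookup⇒[]=)
open import Data.List.Base using (List; []; _∷_; _++_; length; allFin; tabulate)
open import Data.List.Properties using (length-tabulate)
open import Data.List.Relation.Unary.Any using (here)
open import Data.List.Relation.Unary.All as All using (All; []; _∷_)
open import Data.List.Relation.Unary.AllPairs using (_∷_)
open import Data.List.Relation.Unary.Unique.Propositional using (Unique)
open import Data.List.Relation.Unary.Unique.Propositional.Properties using (allFin⁺)
open import Data.List.Membership.Propositional using () renaming (_∈_ to _∈ₗ_)
open import Data.List.Membership.Propositional.Properties using (∈-allFin; ∈-++⁻)
open import Data.Product.Base using (_×_; _,_; proj₁; proj₂; Σ; ∃-syntax)
open import Data.Sum.Base using (inj₁; inj₂; [_,_]′)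
open import Data.Empty using (⊥-elim)
open import Function.Base using (_∘_)
open import Relation.Nullary using (Dec; yes; no)
open import Relation.Binary.PropositionalEquality using (_≡_; _≢_; refl; sym; trans; cong; subst; ≢-sym)

private
  variable
    n : ℕ
    i x y z : Fin n

output : Algorithm n → Subset n → Subset n
output A D = proj₁ (run A D)

cost : Algorithm n → Subset n → ℕ
cost A D = proj₂ (run A D)

∣p∣≡∣p∩q∣+∣p∩∁q∣ : ∀ (p q : Subset n) → ∣ p ∣ ≡ ∣ p ∩ q ∣ + ∣ p ∩ ∁ q ∣
∣p∣≡∣p∩q∣+∣p∩∁q∣ []          []          = refl
∣p∣≡∣p∩q∣+∣p∩∁q∣ (true ∷ p)  (true ∷ q)  = cong suc (∣p∣≡∣p∩q∣+∣p∩∁q∣ p q)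
∣p∣≡∣p∩q∣+∣p∩∁q∣ (true ∷ p)  (false ∷ q) =
  trans (cong suc (∣p∣≡∣p∩q∣+∣p∩∁q∣ p q)) (sym (+-suc ∣ p ∩ q ∣ _))
∣p∣≡∣p∩q∣+∣p∩∁q∣ (false ∷ p) (true ∷ q)  = ∣p∣≡∣p∩q∣+∣p∩∁q∣ p q
∣p∣≡∣p∩q∣+∣p∩∁q∣ (false ∷ p) (false ∷ q) = ∣p∣≡∣p∩q∣+∣p∩∁q∣ p q

∣p∣≡0⇒p≡⊥ : ∀ {p : Subset n} → ∣ p ∣ ≡ 0 → p ≡ ⊥
∣p∣≡0⇒p≡⊥ {p = []}        _    = refl
∣p∣≡0⇒p≡⊥ {p = false ∷ p} ∣p∣≡0 = cong (outside ∷_) (∣p∣≡0⇒p≡⊥ ∣p∣≡0)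

∣p∣≡1⇒p≡⁅x⁆ : ∀ {p : Subset n} → ∣ p ∣ ≡ 1 → ∃[ x ] p ≡ ⁅ x ⁆
∣p∣≡1⇒p≡⁅x⁆ {p = true ∷ p}  ∣p∣≡1 = zero , cong (inside ∷_) (∣p∣≡0⇒p≡⊥ (cong pred ∣p∣≡1))
∣p∣≡1⇒p≡⁅x⁆ {p = false ∷ p} ∣p∣≡1 with ∣p∣≡1⇒p≡⁅x⁆ ∣p∣≡1
... | x , p≡⁅x⁆ = suc x , cong (outside ∷_) p≡⁅x⁆

0<∣p∣⇒Nonempty : ∀ {n} {p : Subset n} → 0 < ∣ p ∣ → Nonempty p
0<∣p∣⇒Nonempty {n} {p} 0<∣p∣ with nonempty? p
... | yes ne = ne
... | no ∄ = ⊥-elim (<⇒≱ 0<∣p∣ (≤-reflexive (trans (cong ∣_∣ (Empty-unique ∄)) (∣⊥∣≡0 n))))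

∣⁅x⁆∪⁅y⁆∣≡2 : x ≢ y → ∣ ⁅ x ⁆ ∪ ⁅ y ⁆ ∣ ≡ 2
∣⁅x⁆∪⁅y⁆∣≡2 {x = zero}  {zero}  x≢y = ⊥-elim (x≢y refl)
∣⁅x⁆∪⁅y⁆∣≡2 {x = zero}  {suc y} _   = cong suc (trans (cong ∣_∣ (∪-identityˡ ⁅ y ⁆)) (∣⁅x⁆∣≡1 y))
∣⁅x⁆∪⁅y⁆∣≡2 {x = suc x} {zero}  _   = cong suc (trans (cong ∣_∣ (∪-identityʳ ⁅ x ⁆)) (∣⁅x⁆∣≡1 x))
∣⁅x⁆∪⁅y⁆∣≡2 {x = suc x} {suc y} x≢y = ∣⁅x⁆∪⁅y⁆∣≡2 (x≢y ∘ cong suc)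

testOutcome-⁅⁆ : ∀ {n} (T : Subset n) i → testOutcome T ⁅ i ⁆ ≡ lookup T i
testOutcome-⁅⁆         (true ∷ T)  zero    = refl
testOutcome-⁅⁆ {suc n} (false ∷ T) zero    = cong (λ k → not (k ≡ᵇ 0)) (trans (cong ∣_∣ (∩-zeroʳ T)) (∣⊥∣≡0 n))
testOutcome-⁅⁆         (true ∷ T)  (suc i) = testOutcome-⁅⁆ T i
testOutcome-⁅⁆         (false ∷ T) (suc i) = testOutcome-⁅⁆ T i

module _ {T : Subset n} {A B : Algorithm n} where

  run-node-∈ : i ∈ T → run (node T A B) ⁅ i ⁆ ≡ (output A ⁅ i ⁆ , suc (cost A ⁅ i ⁆))
  run-node-∈ {i = i} i∈T rewrite testOutcome-⁅⁆ T i | []=⇒lookup i∈T = refl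

  run-node-∉ : i ∉ T → run (node T A B) ⁅ i ⁆ ≡ (output B ⁅ i ⁆ , suc (cost B ⁅ i ⁆))
  run-node-∉ {i = i} i∉T rewrite testOutcome-⁅⁆ T i | ¬-not (i∉T ∘ lookup⇒[]= i T) = refl

  0<cost-node : ∀ D → 0 < cost (node T A B) D
  0<cost-node D with testOutcome T D
  ... | true  = s≤s z≤n
  ... | false = s≤s z≤n

Identifies : Algorithm n → Subset n → Set
Identifies A C = ∀ {i} → i ∈ C → output A ⁅ i ⁆ ≡ ⁅ i ⁆

identifies-leaf⇒⊆⁅⁆ : ∀ {S C : Subset n} → Identifies (leaf S) C → i ∈ C → C ⊆ ⁅ i ⁆
identifies-leaf⇒⊆⁅⁆ identifies i∈C {j} j∈C = subst (j ∈_) (trans (sym (identifies j∈C)) (identifies i∈C)) (x∈⁅x⁆ j)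

module _ {T : Subset n} {A B : Algorithm n} {C : Subset n} (identifies : Identifies (node T A B) C) where

  identifies-∩ : Identifies A (C ∩ T)
  identifies-∩ i∈C∩T with x∈p∩q⁻ C T i∈C∩T
  ... | i∈C , i∈T = trans (sym (cong proj₁ (run-node-∈ i∈T))) (identifies i∈C)

  identifies-∩∁ : Identifies B (C ∩ ∁ T)
  identifies-∩∁ i∈C∖T with x∈p∩q⁻ C (∁ T) i∈C∖T
  ... | i∈C , i∉T = trans (sym (cong proj₁ (run-node-∉ (x∈∁p⇒x∉p {p = T} i∉T)))) (identifies i∈C)

NeedsHalf : Algorithm n → Subset n → Set
NeedsHalf A C = ∃[ i ] (i ∈ C × ⌈ ∣ C ∣ /2⌉ ≤ cost A ⁅ i ⁆)

needsHalf-step : ∀ {A B : Algorithm n} {C C′ : Subset n} → C′ ⊆ C → ∣ C ∣ ≤ 2 + ∣ C′ ∣ →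
                 (∀ {i} → i ∈ C′ → cost A ⁅ i ⁆ ≡ suc (cost B ⁅ i ⁆)) →
                 NeedsHalf B C′ → NeedsHalf A C
needsHalf-step {A = A} {B} {C} {C′} C′⊆C ∣C∣≤2+∣C′∣ cost≡ (i , i∈C′ , bound) = i , C′⊆C i∈C′ , (begin
  ⌈ ∣ C ∣ /2⌉         ≤⟨ ⌈n/2⌉-mono ∣C∣≤2+∣C′∣ ⟩
  suc ⌈ ∣ C′ ∣ /2⌉    ≤⟨ s≤s bound ⟩
  suc (cost B ⁅ i ⁆)  ≡⟨ cost≡ i∈C′ ⟨
  cost A ⁅ i ⁆        ∎)
  where open ≤-Reasoning

needsHalf-node : ∀ {T : Subset n} {A B C} → ∣ T ∣ ≡ 2 → 2 ≤ ∣ C ∣ →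
                 (2 ≤ ∣ C ∩ T ∣ → NeedsHalf A (C ∩ T)) →
                 (2 ≤ ∣ C ∩ ∁ T ∣ → NeedsHalf B (C ∩ ∁ T)) →
                 NeedsHalf (node T A B) C
needsHalf-node {T = T} {A} {B} {C} ∣T∣≡2 2≤∣C∣ needsA needsB = by-cases (b ≤? 1) (a ≤? 1)
  where
  a b : ℕ
  a = ∣ C ∩ T ∣
  b = ∣ C ∩ ∁ T ∣

  ∣C∣≡a+b : ∣ C ∣ ≡ a + b
  ∣C∣≡a+b = ∣p∣≡∣p∩q∣+∣p∩∁q∣ C T

  a≤2 : a ≤ 2
  a≤2 = ≤-trans (∣p∩q∣≤∣q∣ C T) (≤-reflexive ∣T∣≡2)

  by-cases : Dec (b ≤ 1) → Dec (a ≤ 1) → NeedsHalf (node T A B) C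
  by-cases (no b≰1) _ =
    needsHalf-step {A = node T A B} {B = B} (p∩q⊆p C (∁ T))
      (≤-trans (≤-reflexive ∣C∣≡a+b) (+-monoˡ-≤ b a≤2))
      (λ i∈ → cong proj₂ (run-node-∉ (x∈∁p⇒x∉p {p = T} (proj₂ (x∈p∩q⁻ C (∁ T) i∈))))) (needsB (≰⇒> b≰1))
  by-cases (yes b≤1) (no a≰1) =
    needsHalf-step {A = node T A B} {B = A} (p∩q⊆p C T)
      (≤-trans (≤-reflexive (trans ∣C∣≡a+b (+-comm a b))) (+-monoˡ-≤ a (≤-trans b≤1 (s≤s z≤n))))
      (λ i∈ → cong proj₂ (run-node-∈ (proj₂ (x∈p∩q⁻ C T i∈)))) (needsA (≰⇒> a≰1))
  by-cases (yes b≤1) (yes a≤1) with 0<∣p∣⇒Nonempty (≤-trans (s≤s z≤n) 2≤∣C∣)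
  ... | i , i∈C = i , i∈C ,
    ≤-trans (⌈n/2⌉-mono (≤-trans (≤-reflexive ∣C∣≡a+b) (+-mono-≤ a≤1 b≤1))) (0<cost-node {T = T} {A} {B} ⁅ i ⁆)

adversary : ∀ {A : Algorithm n} {C} → TestsOfSize 2 A → Identifies A C → 2 ≤ ∣ C ∣ → NeedsHalf A C
adversary (leaf S) identifies 2≤∣C∣ with 0<∣p∣⇒Nonempty (≤-trans (s≤s z≤n) 2≤∣C∣)
... | i , i∈C = ⊥-elim (<⇒≱ 2≤∣C∣ (≤-trans (p⊆q⇒∣p∣≤∣q∣ (identifies-leaf⇒⊆⁅⁆ identifies i∈C)) (≤-reflexive (∣⁅x⁆∣≡1 i))))
adversary {A = node T A B} (node ∣T∣≡2 testsA testsB) identifies 2≤∣C∣ =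
  needsHalf-node {T = T} {A} {B} ∣T∣≡2 2≤∣C∣
    (adversary testsA (identifies-∩ identifies)) (adversary testsB (identifies-∩∁ identifies))

IdentifiesWithin : Algorithm n → List (Fin n) → ℕ → Set
IdentifiesWithin A xs c = ∀ {i} → i ∈ₗ xs → output A ⁅ i ⁆ ≡ ⁅ i ⁆ × cost A ⁅ i ⁆ ≤ c

identifiesWithin-leaf : IdentifiesWithin (leaf ⁅ x ⁆) (x ∷ []) 0
identifiesWithin-leaf (here refl) = refl , z≤n

identifiesWithin-mono : ∀ {A : Algorithm n} {xs c d} → c ≤ d → IdentifiesWithin A xs c → IdentifiesWithin A xs d
identifiesWithin-mono c≤d identifies i∈xs with identifies i∈xs
... | output≡ , cost≤c = output≡ , ≤-trans cost≤c c≤d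

identifiesWithin-node : ∀ {T : Subset n} {A B xs ys c} → All (_∈ T) xs → All (_∉ T) ys →
                        IdentifiesWithin A xs c → IdentifiesWithin B ys c →
                        IdentifiesWithin (node T A B) (xs ++ ys) (suc c)
identifiesWithin-node {n} {T} {A} {B} {xs} {c = c} xs∈T ys∉T identifiesA identifiesB i∈ =
  [ (λ i∈xs → via {C = A} (run-node-∈ (All.lookup xs∈T i∈xs)) (identifiesA i∈xs))
  , (λ i∈ys → via {C = B} (run-node-∉ (All.lookup ys∉T i∈ys)) (identifiesB i∈ys)) ]′ (∈-++⁻ xs i∈)
  where
  via : ∀ {C : Algorithm n} {i} → run (node T A B) ⁅ i ⁆ ≡ (output C ⁅ i ⁆ , suc (cost C ⁅ i ⁆)) →
        output C ⁅ i ⁆ ≡ ⁅ i ⁆ × cost C ⁅ i ⁆ ≤ c →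
        output (node T A B) ⁅ i ⁆ ≡ ⁅ i ⁆ × cost (node T A B) ⁅ i ⁆ ≤ suc c
  via run≡ (output≡ , cost≤c) = trans (cong proj₁ run≡) output≡ , ≤-trans (≤-reflexive (cong proj₂ run≡)) (s≤s cost≤c)

∉⁅x⁆∪⁅y⁆ : x ≢ i → y ≢ i → i ∉ ⁅ x ⁆ ∪ ⁅ y ⁆
∉⁅x⁆∪⁅y⁆ {x = x} {y = y} x≢i y≢i i∈ =
  [ x≢i ∘ sym ∘ x∈⁅y⁆⇒x≡y x , y≢i ∘ sym ∘ x∈⁅y⁆⇒x≡y y ]′ (x∈p∪q⁻ ⁅ x ⁆ ⁅ y ⁆ i∈)

-- Splits the suspects x and y; the item z must lie outside {x, y}.
resolvePair : Fin n → Fin n → Fin n → Algorithm n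
resolvePair x y z = node (⁅ x ⁆ ∪ ⁅ z ⁆) (leaf ⁅ x ⁆) (leaf ⁅ y ⁆)

testPair : Fin n → Fin n → Fin n → Algorithm n → Algorithm n
testPair x y z A = node (⁅ x ⁆ ∪ ⁅ y ⁆) (resolvePair x y z) A

-- Searches x ∷ y ∷ z ∷ r; a final pair z w is split against x, cleared by then.
pairUp : Fin n → Fin n → Fin n → List (Fin n) → Algorithm n
pairUp x y z []          = testPair x y z (leaf ⁅ z ⁆)
pairUp x y z (w ∷ [])    = testPair x y z (resolvePair z w x)
pairUp x y z (w ∷ v ∷ r) = testPair x y z (pairUp z w v r)

resolvePair-tests : x ≢ z → TestsOfSize 2 (resolvePair x y z)
resolvePair-tests x≢z = node (∣⁅x⁆∪⁅y⁆∣≡2 x≢z) (leaf _) (leaf _)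

testPair-tests : ∀ {A : Algorithm n} → x ≢ y → x ≢ z → TestsOfSize 2 A → TestsOfSize 2 (testPair x y z A)
testPair-tests x≢y x≢z testsA = node (∣⁅x⁆∪⁅y⁆∣≡2 x≢y) (resolvePair-tests x≢z) testsA

pairUp-tests : ∀ {r} → Unique (x ∷ y ∷ z ∷ r) → TestsOfSize 2 (pairUp x y z r)
pairUp-tests {r = []}        ((x≢y ∷ x≢z ∷ _) ∷ _)     = testPair-tests x≢y x≢z (leaf _)
pairUp-tests {r = w ∷ []}    ((x≢y ∷ x≢z ∷ _) ∷ _)     = testPair-tests x≢y x≢z (resolvePair-tests (≢-sym x≢z))
pairUp-tests {r = w ∷ v ∷ r} ((x≢y ∷ x≢z ∷ _) ∷ _ ∷ u) = testPair-tests x≢y x≢z (pairUp-tests u)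

resolvePair-identifies : x ≢ y → z ≢ y → IdentifiesWithin (resolvePair x y z) (x ∷ y ∷ []) 1
resolvePair-identifies x≢y z≢y =
  identifiesWithin-node (x∈p∪q⁺ (inj₁ (x∈⁅x⁆ _)) ∷ []) (∉⁅x⁆∪⁅y⁆ x≢y z≢y ∷ []) identifiesWithin-leaf identifiesWithin-leaf

testPair-identifies : ∀ {A : Algorithm n} {zs c} → Unique (x ∷ y ∷ z ∷ zs) → 1 ≤ c →
                      IdentifiesWithin A (z ∷ zs) c → IdentifiesWithin (testPair x y z A) (x ∷ y ∷ z ∷ zs) (suc c)
testPair-identifies {x = x} {y} {z} ((x≢y ∷ x≢zs) ∷ (y≢zs@(y≢z ∷ _)) ∷ _) 1≤c identifiesA =
  identifiesWithin-node (x∈p∪q⁺ (inj₁ (x∈⁅x⁆ _)) ∷ x∈p∪q⁺ (inj₂ (x∈⁅x⁆ _)) ∷ [])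
    (All.zipWith (λ (x≢i , y≢i) → ∉⁅x⁆∪⁅y⁆ x≢i y≢i) (x≢zs , y≢zs))
    (identifiesWithin-mono {A = resolvePair x y z} 1≤c (resolvePair-identifies x≢y (≢-sym y≢z))) identifiesA

pairUp-identifies : ∀ {r} → Unique (x ∷ y ∷ z ∷ r) → IdentifiesWithin (pairUp x y z r) (x ∷ y ∷ z ∷ r) ⌈ 3 + length r /2⌉
pairUp-identifies {z = z} {r = []} u =
  testPair-identifies {A = leaf ⁅ z ⁆} u (s≤s z≤n) (identifiesWithin-mono {A = leaf ⁅ z ⁆} z≤n identifiesWithin-leaf)
pairUp-identifies {r = w ∷ []} u@((_ ∷ _ ∷ x≢w ∷ []) ∷ _ ∷ (z≢w ∷ []) ∷ _) =
  testPair-identifies u (s≤s z≤n) (resolvePair-identifies z≢w x≢w)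
pairUp-identifies {z = z} {r = w ∷ v ∷ r} u@(_ ∷ _ ∷ u′) =
  testPair-identifies {A = pairUp z w v r} u (s≤s z≤n) (pairUp-identifies u′)

identifiesWithin-allFin⇒solves : ∀ {A : Algorithm n} {c} → IdentifiesWithin A (allFin n) c →
                                 Solves 1 A × WorstCaseAtMost 1 A c
identifiesWithin-allFin⇒solves {A = A} {c} identifies = solves , worstCase
  where
  solves : Solves 1 A
  solves D ∣D∣≡1 with ∣p∣≡1⇒p≡⁅x⁆ {p = D} ∣D∣≡1
  ... | x , refl = proj₁ (identifies (∈-allFin x))
  worstCase : WorstCaseAtMost 1 A c
  worstCase D ∣D∣≡1 with ∣p∣≡1⇒p≡⁅x⁆ {p = D} ∣D∣≡1
  ... | x , refl = proj₂ (identifies (∈-allFin x))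

pairUpAll : ∀ m → Algorithm (3 + m)
pairUpAll m = pairUp zero (suc zero) (suc (suc zero)) (tabulate {n = m} (λ i → suc (suc (suc i))))

pairUpAll-identifies : ∀ m → IdentifiesWithin (pairUpAll m) (allFin (3 + m)) ⌈ 3 + m /2⌉
pairUpAll-identifies m =
  subst (λ k → IdentifiesWithin (pairUpAll m) (allFin (3 + m)) ⌈ 3 + k /2⌉)
        (length-tabulate {n = m} (λ i → suc (suc (suc i)))) (pairUp-identifies (allFin⁺ (3 + m)))

lowerBound : ∀ (A : Algorithm n) → Admissible 2 1 n A → 2 ≤ n →
             Σ (Subset n) λ D → (∣ D ∣ ≡ 1) × (⌈ n /2⌉ ≤ cost A D)
lowerBound {n} A (testsA , solvesA) 2≤n = from (adversary testsA identifiesAll 2≤∣⊤∣)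
  where
  identifiesAll : Identifies A ⊤
  identifiesAll {i} _ = solvesA ⁅ i ⁆ (∣⁅x⁆∣≡1 i)

  2≤∣⊤∣ : 2 ≤ ∣ ⊤ {n} ∣
  2≤∣⊤∣ = subst (2 ≤_) (sym (∣⊤∣≡n n)) 2≤n

  from : NeedsHalf A ⊤ → Σ (Subset n) λ D → (∣ D ∣ ≡ 1) × (⌈ n /2⌉ ≤ cost A D)
  from (i , _ , bound) = ⁅ i ⁆ , ∣⁅x⁆∣≡1 i , subst (λ k → ⌈ k /2⌉ ≤ cost A ⁅ i ⁆) (∣⊤∣≡n n) bound

corollary2 : ∀ (n : ℕ) → 3 ≤ n → M≡ 2 1 n ⌈ n /2⌉
corollary2 (suc (suc (suc m))) (s≤s (s≤s (s≤s _))) =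
  let solves , worstCase = identifiesWithin-allFin⇒solves {A = pairUpAll m} (pairUpAll-identifies m) in
  (pairUpAll m , (pairUp-tests (allFin⁺ (3 + m)) , solves) , worstCase) ,
  λ A admissible → lowerBound A admissible (s≤s (s≤s z≤n))
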